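{- (1) If a string language $L$ is generated by a string $\mathrm{MILL}1$ grammar, then there is a hypergraph $\mathrm{MILL}1$ grammar $\mathcal{G}$ such that $L^{\mathit{str}}(\mathcal{G})=L$. (2) Conversely, if $\mathcal{G}$ is a hypergraph $\mathrm{MILL}1$ grammar, then $L^{\mathit{str}}(\mathcal{G})\setminus\{\varepsilon\}$ is generated by some string $\mathrm{MILL}1$ grammar.
   Context: $\mathrm{MILL}1$ is first-order multiplicative intuitionistic linear logic: formulas are built from atomic formulas $p(x_1,\dots,x_n)$ (predicate symbols applied to variables; no function symbols, no constants) using $\otimes,\multimap,\exists,\forall$; sequents $\Gamma\vdash B$ have a multiset $\Gamma$ of formulas on the left and one formula on the right; derivability is in the standard sequent calculus (axiom $A\vdash A$, left/right rules for $\otimes,\multimap,\exists,\forall$, eigenvariable conditions for $\exists L,\forall R$). $\mathrm{FVar}(A)$ is the set of free variables of $A$; $A[h]$ is the capture-avoiding substitution of $h(x)$ for free $x$. Selectors and variables are the same kind of objects; fix a countable set $\Sigma$ of them. A $\Sigma$-typed alphabet is a set $C$ with a map $\mathrm{type}$ assigning to each $c\in C$ a finite subset of $\Sigma$; each $c$ is treated as a predicate symbol of arity $|\mathrm{type}(c)|$ (with a fixed enumeration $\mathrm{type}(c)=\{\sigma_1,\dots,\sigma_n\}$, and for $h:\mathrm{type}(c)\to\mathrm{Var}$, $c[h]$ denotes $c(h(\sigma_1),\dots,h(\sigma_n))$). A hypergraph over $C$ is $H=\langle V_H,E_H,\mathit{lab}_H,\mathit{att}_H,\mathit{ext}_H\rangle$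 with finite node set $V_H$ (nodes are also regarded as variables), finite hyperedge set $E_H$, $\mathit{lab}_H:E_H\to C$, $\mathit{att}_H(e):\mathrm{type}(\mathit{lab}_H(e))\to V_H$ for each $e$, and $\mathit{ext}_H:\mathrm{type}(H)\to V_H$ where $\mathrm{type}(H)\subseteq\Sigma$. Hypergraphs are considered up to isomorphism. Fix two distinct variables/selectors $\mathbf{s},\mathbf{t}$. For a string $w=a_1\dots a_n$ over letters $a_i$ of type $\{\mathbf{s},\mathbf{t}\}$, the string graph $\mathrm{sg}(w)$ has nodes $v_0,\dots,v_n$, hyperedges $e_1,\dots,e_n$ with $\mathit{lab}(e_i)=a_i$, $\mathit{att}(e_i)(\mathbf{s})=v_{i-1}$, $\mathit{att}(e_i)(\mathbf{t})=v_i$, and $\mathit{ext}(\mathbf{s})=v_0$, $\mathit{ext}(\mathbf{t})=v_n$. A string $\mathrm{MILL}1$ grammar is $\langle T,S,\triangleright\rangle$ with $T$ a finite alphabet, $S$ a formula with $\mathrm{FVar}(S)\subseteq\{\mathbf{s},\mathbf{t}\}$, and $\triangleright\subseteq T\times\mathrm{Fm}$ a finite relation with $a\triangleright A\Rightarrow\mathrm{FVar}(A)\subseteq\{\mathbf{s},\mathbf{t}\}$. It generates $a_1\dots a_n$ iff there are $A_i$ with $a_i\triangleright A_i$ such that $A_1[x_0/\mathbf{s},x_1/\mathbf{t}],\dots,A_n[x_{n-1}/\mathbf{s},x_n/\mathbf{t}]\vdash S[x_0/\mathbf{s},x_n/\mathbf{t}]$ is derivable in $\mathrm{MILL}1$,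 for distinct variables $x_0,\dots,x_n$. Fix a variable $x_\bullet$ and a symbol $\bullet$. A hypergraph $\mathrm{MILL}1$ grammar is $\mathcal{G}=\langle T,S,X,\triangleright\rangle$ with $T$ a finite $\Sigma$-typed alphabet, $\triangleright\subseteq(T\cup\{\bullet\})\times\mathrm{Fm}$ a finite relation such that $a\triangleright A$ implies $\mathrm{FVar}(A)\subseteq\mathrm{type}(a)$ and $\bullet\triangleright A$ implies $\mathrm{FVar}(A)\subseteq\{x_\bullet\}$, and $S$ a formula with $\mathrm{FVar}(S)\subseteq X\subseteq\Sigma$. A hypergraph $H$ over $T$ belongs to $L(\mathcal{G})$ iff $\mathrm{type}(H)=X$ and there are maps $h_V:V_H\to\mathrm{Fm}$, $h_E:E_H\to\mathrm{Fm}$ with $\bullet\triangleright h_V(v)$, $\mathit{lab}_H(e)\triangleright h_E(e)$, such that the sequent $\{h_E(e)[\mathit{att}_H(e)]\mid e\in E_H\},\{h_V(v)[v/x_\bullet]\mid v\in V_H\}\vdash S[\mathit{ext}_H]$ is derivable in $\mathrm{MILL}1$. The string language of $\mathcal{G}$ is $L^{\mathit{str}}(\mathcal{G})=\{w\mid\mathrm{sg}(w)\in L(\mathcal{G})\}$. -}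

module Defs where

open import Data.Nat using (ℕ; zero; suc; _≟_)
open import Data.Fin using (Fin; zero; suc; toℕ; inject₁; fromℕ)
open import Data.List using (List; []; _∷_; _++_; map; concatMap; length; allFin)
open import Data.List.Membership.Propositional using (_∈_; _∉_)
open import Data.List.Membership.DecPropositional _≟_ using (_∈?_)
open import Data.List.Relation.Unary.All using (All)
open import Data.List.Relation.Binary.Pointwise using (Pointwise)
open import Data.List.Relation.Binary.Permutation.Propositional using (_↭_)
open import Data.Product using (Σ; _×_; _,_)
open import Data.Sum using (_⊎_)
open import Relation.Binary.PropositionalEquality using (_≡_)
open import Relation.Nullary using (yes; no)

-- Variables = selectors = ℕ.  Fixed distinguished variables.

Var : Set
Var = ℕ

𝐬 𝐭 x• : Var
𝐬 = 0
𝐭 = 1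
x• = 2

-- MILL1 formulas (locally nameless: free variables are names in ℕ,
-- bound variables are well-scoped de Bruijn indices).  Predicate
-- symbols are natural numbers.

data Tm (n : ℕ) : Set where
  fv : Var → Tm n
  bv : Fin n → Tm n

data Fm (n : ℕ) : Set where
  at   : ℕ → List (Tm n) → Fm n
  _⊗_  : Fm n → Fm n → Fm n
  _⊸_  : Fm n → Fm n → Fm n
  ∃′   : Fm (suc n) → Fm n
  ∀′   : Fm (suc n) → Fm n

Form : Set
Form = Fm 0

fvT : ∀ {n} → Tm n → List Var
fvT (fv x) = x ∷ []
fvT (bv _) = []

fvF : ∀ {n} → Fm n → List Var
fvF (at p ts) = concatMap fvT ts
fvF (A ⊗ B) = fvF A ++ fvF B
fvF (A ⊸ B) = fvF A ++ fvF B
fvF (∃′ A) = fvF A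
fvF (∀′ A) = fvF A

fvL : List Form → List Var
fvL = concatMap fvF

-- substitution of variables for free variables, A[h]
-- (automatically capture-avoiding: bound variables are indices)
renT : ∀ {n} → (Var → Var) → Tm n → Tm n
renT h (fv x) = fv (h x)
renT h (bv i) = bv i

renF : ∀ {n} → (Var → Var) → Fm n → Fm n
renF h (at p ts) = at p (map (renT h) ts)
renF h (A ⊗ B) = renF h A ⊗ renF h B
renF h (A ⊸ B) = renF h A ⊸ renF h B
renF h (∃′ A) = ∃′ (renF h A)
renF h (∀′ A) = ∀′ (renF h A)

wkT : ∀ {n} → Tm n → Tm (suc n)
wkT (fv x) = fv x
wkT (bv i) = bv (suc i)

liftσ : ∀ {m n} → (Fin m → Tm n) → Fin (suc m) → Tm (suc n)
liftσ σ zero = bv zero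
liftσ σ (suc i) = wkT (σ i)

instT : ∀ {m n} → (Fin m → Tm n) → Tm m → Tm n
instT σ (fv x) = fv x
instT σ (bv i) = σ i

instF : ∀ {m n} → (Fin m → Tm n) → Fm m → Fm n
instF σ (at p ts) = at p (map (instT σ) ts)
instF σ (A ⊗ B) = instF σ A ⊗ instF σ B
instF σ (A ⊸ B) = instF σ A ⊸ instF σ B
instF σ (∃′ A) = ∃′ (instF (liftσ σ) A)
instF σ (∀′ A) = ∀′ (instF (liftσ σ) A)

open₁ : Fm 1 → Var → Form
open₁ A y = instF (λ _ → fv y) A

-- Sequent calculus for MILL1 (antecedent a list up to permutation,
-- i.e. a multiset).

infix 4 _⊢_
data _⊢_ : List Form → Form → Set where
  ax   : ∀ {A} → A ∷ [] ⊢ A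
  cut  : ∀ {Γ Δ A C} → Γ ⊢ A → A ∷ Δ ⊢ C → Γ ++ Δ ⊢ C
  exch : ∀ {Γ Δ C} → Γ ↭ Δ → Γ ⊢ C → Δ ⊢ C
  ⊗L   : ∀ {Γ A B C} → A ∷ B ∷ Γ ⊢ C → (A ⊗ B) ∷ Γ ⊢ C
  ⊗R   : ∀ {Γ Δ A B} → Γ ⊢ A → Δ ⊢ B → Γ ++ Δ ⊢ A ⊗ B
  ⊸L   : ∀ {Γ Δ A B C} → Γ ⊢ A → B ∷ Δ ⊢ C → (A ⊸ B) ∷ Γ ++ Δ ⊢ C
  ⊸R   : ∀ {Γ A B} → A ∷ Γ ⊢ B → Γ ⊢ A ⊸ B
  ∃L   : ∀ {Γ A C} y → y ∉ fvL (C ∷ ∃′ A ∷ Γ) →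
         open₁ A y ∷ Γ ⊢ C → ∃′ A ∷ Γ ⊢ C
  ∃R   : ∀ {Γ A} z → Γ ⊢ open₁ A z → Γ ⊢ ∃′ A
  ∀L   : ∀ {Γ A C} z → open₁ A z ∷ Γ ⊢ C → ∀′ A ∷ Γ ⊢ C
  ∀R   : ∀ {Γ A} y → y ∉ fvL (∀′ A ∷ Γ) →
         Γ ⊢ open₁ A y → Γ ⊢ ∀′ A

Lang : Set₁
Lang = List ℕ → Set

_≐_ : Lang → Lang → Set
L ≐ M = ∀ w → (L w → M w) × (M w → L w)

st : Var → Var → Var → Var
st x y v with v ≟ 𝐬
... | yes _ = x
... | no _ with v ≟ 𝐭
...   | yes _ = y
...   | no _ = v

bul : Var → Var → Var
bul v u with u ≟ x•
... | yes _ = v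
... | no _ = u

subOn : (xs : List Var) → ((σ : Var) → .(σ ∈ xs) → Var) → Var → Var
subOn xs f v with v ∈? xs
... | yes p = f v p
... | no _ = v

record StrGrammar : Set where
  field
    T      : List ℕ
    S      : Form
    rel    : List (ℕ × Form)
    S-fv   : ∀ x → x ∈ fvF S → x ≡ 𝐬 ⊎ x ≡ 𝐭
    rel-T  : ∀ {a A} → (a , A) ∈ rel → a ∈ T
    rel-fv : ∀ {a A} → (a , A) ∈ rel → ∀ x → x ∈ fvF A → x ≡ 𝐬 ⊎ x ≡ 𝐭

strAnt : ℕ → List Form → List Form
strAnt k [] = []
strAnt k (A ∷ As) = renF (st k (suc k)) A ∷ strAnt (suc k) As

-- the language generated, with the distinct variables xᵢ := i
Generates : StrGrammar → Lang
Generates G w =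
  Σ (List Form) λ As →
    Pointwise (λ a A → (a , A) ∈ StrGrammar.rel G) w As ×
    (strAnt 0 As ⊢ renF (st 0 (length w)) (StrGrammar.S G))

-- Hypergraphs over a Σ-typed alphabet (letters ℕ, types ℕ → List Var).
-- Nodes are Fin nV, regarded as the variables toℕ v.

record Hypergraph (type : ℕ → List Var) : Set where
  field
    nV  : ℕ
    nE  : ℕ
    lab : Fin nE → ℕ
    att : (e : Fin nE) → (σ : Var) → .(σ ∈ type (lab e)) → Fin nV
    ty  : List Var
    ext : (σ : Var) → .(σ ∈ ty) → Fin nV

record HGrammar : Set where
  field
    T       : List ℕ
    type    : ℕ → List Var
    S       : Form
    X       : List Var
    rel     : List (ℕ × Form)    -- ▷ restricted to T
    brel    : List Form          -- formulas A with • ▷ A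
    S-fv    : ∀ x → x ∈ fvF S → x ∈ X
    rel-T   : ∀ {a A} → (a , A) ∈ rel → a ∈ T
    rel-fv  : ∀ {a A} → (a , A) ∈ rel → ∀ x → x ∈ fvF A → x ∈ type a
    brel-fv : ∀ {A} → A ∈ brel → ∀ x → x ∈ fvF A → x ≡ x•

InL : (G : HGrammar) → Hypergraph (HGrammar.type G) → Set
InL G H =
  (∀ e → lab e ∈ T) ×
  (∀ σ → (σ ∈ ty → σ ∈ X) × (σ ∈ X → σ ∈ ty)) ×
  Σ (Fin nV → Form) λ hV → Σ (Fin nE → Form) λ hE →
    (∀ v → hV v ∈ brel) ×
    (∀ e → (lab e , hE e) ∈ rel) ×
    (map (λ e → renF (subOn (type (lab e)) (λ σ p → toℕ (att e σ p))) (hE e)) (allFin nE)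
      ++ map (λ v → renF (bul (toℕ v)) (hV v)) (allFin nV)
     ⊢ renF (subOn ty (λ σ p → toℕ (ext σ p))) S)
  where open HGrammar G
        open Hypergraph H

lookupL : (w : List ℕ) → Fin (length w) → ℕ
lookupL (a ∷ w) zero = a
lookupL (a ∷ w) (suc i) = lookupL w i

sg : (type : ℕ → List Var) → List ℕ → Hypergraph type
sg type w = record
  { nV  = suc (length w)
  ; nE  = length w
  ; lab = lookupL w
  ; att = λ e σ _ → attv e σ
  ; ty  = 𝐬 ∷ 𝐭 ∷ []
  ; ext = λ σ _ → extv σ
  }
  where
    attv : Fin (length w) → Var → Fin (suc (length w))
    attv e σ with σ ≟ 𝐬
    ... | yes _ = inject₁ e
    ... | no _ = suc e
    extv : Var → Fin (suc (length w))
    extv σ with σ ≟ 𝐬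
    ... | yes _ = zero
    ... | no _ = fromℕ (length w)

HasTypeST : (ℕ → List Var) → ℕ → Set
HasTypeST type a = ∀ σ → (σ ∈ type a → σ ≡ 𝐬 ⊎ σ ≡ 𝐭) × (σ ≡ 𝐬 ⊎ σ ≡ 𝐭 → σ ∈ type a)

LStr : HGrammar → Lang
LStr G w = All (HasTypeST (HGrammar.type G)) w × InL G (sg (HGrammar.type G) w)

minusε : Lang → Lang
minusε L w = L w × (w ≡ [] → Data.Empty.⊥)
  where import Data.Empty

-- (1) Give every letter the type {𝐬, 𝐭} and its formulas, every node the formula Q ⊸ Q for a fresh nullary Q,
-- and take (Q ⊸ Q) ⊗ S as start formula. The node formulas chain to a proof of Q ⊸ Q. Conversely they are
-- provable, hence can be cut away, and substituting for Q the provable formula ∀𝐭 ∀𝐬 (S ⊸ S), a left unit for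
-- every instance of S, removes the conjunct Q ⊸ Q.
-- (2) Unless X = {𝐬, 𝐭} no string graph is generated. Otherwise a letter a of type {𝐬, 𝐭} gets A ⊗ N[𝐭/x•],
-- for A ▷-related to a and N a node formula (that of the target node), possibly tensored with R(𝐬) ⊸ N₀[𝐬/x•]
-- for a fresh unary R; the start formula is R(𝐬) ⊸ S. Counting occurrences of R, an invariant of derivability,
-- shows that exactly one letter carries such an N₀, which plays the role of the first node's formula:
-- substituting N₀[y/x•] for R(y) turns a derivation of the string sequent into one of the hypergraph sequent.

module Submission where

open import Defs
open import Data.Empty using (⊥; ⊥-elim)
open import Data.Fin using (Fin; zero; suc; toℕ; _↑ˡ_; _↑ʳ_)
open import Data.Fin.Properties using (toℕ-inject₁; toℕ-fromℕ)
open import Data.Integer using (ℤ; +_; -_; _-_) renaming (_+_ to _+ℤ_)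
open import Data.Integer.Properties using (neg-distrib-+; pos-+; neg-injective; +-injective)
open import Data.Integer.Solver using (module +-*-Solver)
open import Data.List using (List; []; _∷_; _++_; map; concatMap; concat; length; allFin; tabulate; foldr; filter)
open import Data.List.Properties using (map-++; map-cong; map-∘; map-id; map-id-local; map-tabulate; tabulate-cong; ++-assoc; ++-identityʳ)
open import Data.List.Membership.Propositional using (_∈_; _∉_; find; lose)
open import Data.List.Membership.Propositional.Properties using (∈-++⁺ˡ; ∈-++⁺ʳ; ∈-++⁻; ∈-map⁺; ∈-map⁻; ∈-filter⁺; ∈-filter⁻; ∈-concatMap⁺; ∈-concatMap⁻)
open import Data.List.Relation.Binary.Subset.Propositional using (_⊆_)
open import Data.List.Relation.Binary.Subset.Propositional.Properties using (++⁺)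
open import Data.List.Relation.Binary.Permutation.Propositional using (_↭_; ↭-refl; ↭-sym; ↭-trans; ↭-prep; ↭-swap)
import Data.List.Relation.Binary.Permutation.Propositional as ↭
open import Data.List.Relation.Binary.Permutation.Propositional.Properties using (shift; shifts; ++-comm)
import Data.List.Relation.Binary.Permutation.Propositional.Properties as ↭
open import Data.List.Relation.Binary.Pointwise using (Pointwise; []; _∷_)
import Data.List.Relation.Binary.Pointwise as Pointwise
open import Data.List.Relation.Unary.All using (All; []; _∷_; all?)
import Data.List.Relation.Unary.All as All
open import Data.List.Relation.Unary.All.Properties using (tabulate⁺)
open import Data.List.Relation.Unary.Any using (here; there)
open import Data.Maybe using (Maybe; just; nothing)
import Data.Maybe.Relation.Unary.All as Maybe
open import Data.Nat using (ℕ; zero; suc; _≟_; _+_; _<_; _≤_; _⊔_; s≤s)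
open import Data.List.Membership.DecPropositional _≟_ using (_∈?_)
open import Data.Nat.ListAction using (sum)
open import Data.Nat.Properties using (<-irrefl; m≤m⊔n; m≤n⇒m≤n⊔o; m≤n⇒m≤o⊔n; m⊔n<o⇒m<o; m⊔n<o⇒n<o; ⊔-lub; +-identityʳ; +-suc; suc-injective)
open import Data.Product using (Σ; ∃-syntax; _×_; _,_; proj₁; proj₂)
import Data.Product as Product
open import Data.Sum using (_⊎_; inj₁; inj₂; [_,_]′)
import Data.Sum as Sum
open import Function using (_∘_; id)
open import Relation.Binary.PropositionalEquality using (_≡_; _≗_; refl; sym; trans; cong; cong₂; subst; subst₂; module ≡-Reasoning)
open import Relation.Nullary using (Dec; yes; no; ¬_)
open import Relation.Nullary.Decidable using (_×-dec_; _⊎-dec_)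

instT-wkT : ∀ {m n} (σ : Fin m → Tm n) (t : Tm m) → instT (liftσ σ) (wkT t) ≡ wkT (instT σ t)
instT-wkT σ (fv x) = refl
instT-wkT σ (bv i) = refl

instT-∘ : ∀ {k m n} {σ : Fin m → Tm n} {ρ : Fin k → Tm m} {ρ′ : Fin k → Tm n} →
  instT σ ∘ ρ ≗ ρ′ → instT σ ∘ instT ρ ≗ instT ρ′
instT-∘ e (fv x) = refl
instT-∘ e (bv i) = e i

liftσ-∘ : ∀ {k m n} {σ : Fin m → Tm n} {ρ : Fin k → Tm m} {ρ′ : Fin k → Tm n} →
  instT σ ∘ ρ ≗ ρ′ → instT (liftσ σ) ∘ liftσ ρ ≗ liftσ ρ′
liftσ-∘ e zero = refl
liftσ-∘ {σ = σ} {ρ} e (suc i) = trans (instT-wkT σ (ρ i)) (cong wkT (e i))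

instF-∘ : ∀ {k m n} {σ : Fin m → Tm n} {ρ : Fin k → Tm m} {ρ′ : Fin k → Tm n} →
  instT σ ∘ ρ ≗ ρ′ → instF σ ∘ instF ρ ≗ instF ρ′
instF-∘ e (at p ts) = cong (at p) (trans (sym (map-∘ ts)) (map-cong (instT-∘ e) ts))
instF-∘ e (A ⊗ B) = cong₂ _⊗_ (instF-∘ e A) (instF-∘ e B)
instF-∘ e (A ⊸ B) = cong₂ _⊸_ (instF-∘ e A) (instF-∘ e B)
instF-∘ e (∃′ A) = cong ∃′ (instF-∘ (liftσ-∘ e) A)
instF-∘ e (∀′ A) = cong ∀′ (instF-∘ (liftσ-∘ e) A)

instT-identity : ∀ {n} {σ : Fin n → Tm n} → σ ≗ bv → instT σ ≗ id
instT-identity e (fv x) = refl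
instT-identity e (bv i) = e i

liftσ-identity : ∀ {n} {σ : Fin n → Tm n} → σ ≗ bv → liftσ σ ≗ bv
liftσ-identity e zero = refl
liftσ-identity e (suc i) = cong wkT (e i)

instF-identity : ∀ {n} {σ : Fin n → Tm n} → σ ≗ bv → instF σ ≗ id
instF-identity e (at p ts) = cong (at p) (trans (map-cong (instT-identity e) ts) (map-id ts))
instF-identity e (A ⊗ B) = cong₂ _⊗_ (instF-identity e A) (instF-identity e B)
instF-identity e (A ⊸ B) = cong₂ _⊸_ (instF-identity e A) (instF-identity e B)
instF-identity e (∃′ A) = cong ∃′ (instF-identity (liftσ-identity e) A)
instF-identity e (∀′ A) = cong ∀′ (instF-identity (liftσ-identity e) A)

renF-∘ : ∀ {n} {h g : Var → Var} (A : Fm n) → renF h (renF g A) ≡ renF (h ∘ g) A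
renF-∘ (at p ts) = cong (at p) (trans (sym (map-∘ ts)) (map-cong renT-∘ ts))
  where
  renT-∘ : ∀ {n h g} (t : Tm n) → renT h (renT g t) ≡ renT (h ∘ g) t
  renT-∘ (fv x) = refl
  renT-∘ (bv i) = refl
renF-∘ (A ⊗ B) = cong₂ _⊗_ (renF-∘ A) (renF-∘ B)
renF-∘ (A ⊸ B) = cong₂ _⊸_ (renF-∘ A) (renF-∘ B)
renF-∘ (∃′ A) = cong ∃′ (renF-∘ A)
renF-∘ (∀′ A) = cong ∀′ (renF-∘ A)

renF-cong : ∀ {n} {h g : Var → Var} (A : Fm n) → (∀ x → x ∈ fvF A → h x ≡ g x) → renF h A ≡ renF g A
renF-cong (at p ts) e = cong (at p) (renTs-cong ts e)
  where
  renTs-cong : ∀ {n h g} (ts : List (Tm n)) → (∀ x → x ∈ concatMap fvT ts → h x ≡ g x) →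
    map (renT h) ts ≡ map (renT g) ts
  renTs-cong [] e = refl
  renTs-cong (fv x ∷ ts) e = cong₂ _∷_ (cong fv (e x (here refl))) (renTs-cong ts (λ y → e y ∘ there))
  renTs-cong (bv i ∷ ts) e = cong (bv i ∷_) (renTs-cong ts e)
renF-cong (A ⊗ B) e = cong₂ _⊗_ (renF-cong A (λ x → e x ∘ ∈-++⁺ˡ)) (renF-cong B (λ x → e x ∘ ∈-++⁺ʳ (fvF A)))
renF-cong (A ⊸ B) e = cong₂ _⊸_ (renF-cong A (λ x → e x ∘ ∈-++⁺ˡ)) (renF-cong B (λ x → e x ∘ ∈-++⁺ʳ (fvF A)))
renF-cong (∃′ A) e = cong ∃′ (renF-cong A e)
renF-cong (∀′ A) e = cong ∀′ (renF-cong A e)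

fvF-renF : ∀ {n} (h : Var → Var) (A : Fm n) → fvF (renF h A) ≡ map h (fvF A)
fvF-renF h (at p ts) = fvTs-renT ts
  where
  fvTs-renT : ∀ {n} (ts : List (Tm n)) → concatMap fvT (map (renT h) ts) ≡ map h (concatMap fvT ts)
  fvTs-renT [] = refl
  fvTs-renT (fv x ∷ ts) = cong (h x ∷_) (fvTs-renT ts)
  fvTs-renT (bv i ∷ ts) = fvTs-renT ts
fvF-renF h (A ⊗ B) = trans (cong₂ _++_ (fvF-renF h A) (fvF-renF h B)) (sym (map-++ h (fvF A) (fvF B)))
fvF-renF h (A ⊸ B) = trans (cong₂ _++_ (fvF-renF h A) (fvF-renF h B)) (sym (map-++ h (fvF A) (fvF B)))
fvF-renF h (∃′ A) = fvF-renF h A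
fvF-renF h (∀′ A) = fvF-renF h A

∈-fvF-renF⁻ : ∀ {n} (h : Var → Var) (A : Fm n) {x} → x ∈ fvF (renF h A) → ∃[ y ] y ∈ fvF A × x ≡ h y
∈-fvF-renF⁻ h A p = ∈-map⁻ h (subst (_ ∈_) (fvF-renF h A) p)

FreeIn : ∀ {m n} → (Fin m → Tm n) → Var → Set
FreeIn {m} σ x = ∃[ i ] x ∈ fvT (σ i)

freeIn-liftσ : ∀ {m n} (σ : Fin m → Tm n) {x} → FreeIn (liftσ σ) x → FreeIn σ x
freeIn-liftσ σ (suc i , q) = i , ∈-fvT-wkT (σ i) q
  where
  ∈-fvT-wkT : ∀ {n x} (t : Tm n) → x ∈ fvT (wkT t) → x ∈ fvT t
  ∈-fvT-wkT (fv y) q = q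

∈-fvF-instF⁻ : ∀ {m n} (σ : Fin m → Tm n) (A : Fm m) {x} → x ∈ fvF (instF σ A) → x ∈ fvF A ⊎ FreeIn σ x
∈-fvF-instF⁻ σ (at p ts) = ∈-fvTs-instT⁻ ts
  where
  ∈-fvTs-instT⁻ : ∀ ts {x} → x ∈ concatMap fvT (map (instT σ) ts) → x ∈ concatMap fvT ts ⊎ FreeIn σ x
  ∈-fvTs-instT⁻ (fv y ∷ ts) (here refl) = inj₁ (here refl)
  ∈-fvTs-instT⁻ (fv y ∷ ts) (there p) = Sum.map₁ there (∈-fvTs-instT⁻ ts p)
  ∈-fvTs-instT⁻ (bv i ∷ ts) p = [ (λ q → inj₂ (i , q)) , ∈-fvTs-instT⁻ ts ]′ (∈-++⁻ (fvT (σ i)) p)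
∈-fvF-instF⁻ σ (A ⊗ B) p =
  [ Sum.map₁ ∈-++⁺ˡ ∘ ∈-fvF-instF⁻ σ A , Sum.map₁ (∈-++⁺ʳ (fvF A)) ∘ ∈-fvF-instF⁻ σ B ]′ (∈-++⁻ (fvF (instF σ A)) p)
∈-fvF-instF⁻ σ (A ⊸ B) p =
  [ Sum.map₁ ∈-++⁺ˡ ∘ ∈-fvF-instF⁻ σ A , Sum.map₁ (∈-++⁺ʳ (fvF A)) ∘ ∈-fvF-instF⁻ σ B ]′ (∈-++⁻ (fvF (instF σ A)) p)
∈-fvF-instF⁻ σ (∃′ A) p = Sum.map₂ (freeIn-liftσ σ) (∈-fvF-instF⁻ (liftσ σ) A p)
∈-fvF-instF⁻ σ (∀′ A) p = Sum.map₂ (freeIn-liftσ σ) (∈-fvF-instF⁻ (liftσ σ) A p)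

absT : ∀ {n k} → (Var → Maybe (Fin k)) → Tm n → Tm (n + k)
absT {n} f (fv y) with f y
... | just j = bv (n ↑ʳ j)
... | nothing = fv y
absT {n} {k} f (bv i) = bv (i ↑ˡ k)

-- Turns the free variables in the domain of f into bound variables, to be bound by k enclosing quantifiers.
absF : ∀ {n k} → (Var → Maybe (Fin k)) → Fm n → Fm (n + k)
absF f (at p ts) = at p (map (absT f) ts)
absF f (A ⊗ B) = absF f A ⊗ absF f B
absF f (A ⊸ B) = absF f A ⊸ absF f B
absF f (∃′ A) = ∃′ (absF f A)
absF f (∀′ A) = ∀′ (absF f A)

module _ {k : ℕ} (f : Var → Maybe (Fin k)) (g : Var → Var) where

  record AbsInstance {n m} (σ : Fin (n + k) → Tm m) (τ : Fin n → Tm m) : Set where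
    field
      on-bound : ∀ i → σ (i ↑ˡ k) ≡ τ i
      on-abstracted : ∀ y j → f y ≡ just j → σ (n ↑ʳ j) ≡ fv (g y)
      on-free : ∀ y → f y ≡ nothing → g y ≡ y
  open AbsInstance

  absInstance-liftσ : ∀ {n m} {σ : Fin (n + k) → Tm m} {τ : Fin n → Tm m} →
    AbsInstance σ τ → AbsInstance (liftσ σ) (liftσ τ)
  on-bound (absInstance-liftσ I) zero = refl
  on-bound (absInstance-liftσ I) (suc i) = cong wkT (on-bound I i)
  on-abstracted (absInstance-liftσ I) y j e = cong wkT (on-abstracted I y j e)
  on-free (absInstance-liftσ I) = on-free I

  instT-absT : ∀ {n m} {σ : Fin (n + k) → Tm m} {τ : Fin n → Tm m} → AbsInstance σ τ → (t : Tm n) →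
    instT σ (absT f t) ≡ instT τ (renT g t)
  instT-absT I (fv y) with f y in eq
  ... | just j = on-abstracted I y j eq
  ... | nothing = cong fv (sym (on-free I y eq))
  instT-absT I (bv i) = on-bound I i

  instF-absF : ∀ {n m} {σ : Fin (n + k) → Tm m} {τ : Fin n → Tm m} → AbsInstance σ τ → (A : Fm n) →
    instF σ (absF f A) ≡ instF τ (renF g A)
  instF-absF I (at p ts) = cong (at p) (trans (sym (map-∘ ts)) (trans (map-cong (instT-absT I) ts) (map-∘ ts)))
  instF-absF I (A ⊗ B) = cong₂ _⊗_ (instF-absF I A) (instF-absF I B)
  instF-absF I (A ⊸ B) = cong₂ _⊸_ (instF-absF I A) (instF-absF I B)
  instF-absF I (∃′ A) = cong ∃′ (instF-absF (absInstance-liftσ I) A)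
  instF-absF I (∀′ A) = cong ∀′ (instF-absF (absInstance-liftσ I) A)

  instF-absF₀ : ∀ {σ : Fin k → Tm 0} → AbsInstance {0} σ (λ ()) → (A : Form) → instF σ (absF f A) ≡ renF g A
  instF-absF₀ I A = trans (instF-absF I A) (instF-identity (λ ()) (renF g A))

∈-fvF-absF⁻ : ∀ {n k} (f : Var → Maybe (Fin k)) (A : Fm n) {x} → x ∈ fvF (absF f A) → x ∈ fvF A × f x ≡ nothing
∈-fvF-absF⁻ f (at p ts) = ∈-fvTs-absT⁻ ts
  where
  ∈-fvTs-absT⁻ : ∀ {n} (ts : List (Tm n)) {x} → x ∈ concatMap fvT (map (absT f) ts) →
    x ∈ concatMap fvT ts × f x ≡ nothing
  ∈-fvTs-absT⁻ (fv y ∷ ts) p with f y in eq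
  ∈-fvTs-absT⁻ (fv y ∷ ts) p | just j = Product.map₁ there (∈-fvTs-absT⁻ ts p)
  ∈-fvTs-absT⁻ (fv y ∷ ts) (here refl) | nothing = here refl , eq
  ∈-fvTs-absT⁻ (fv y ∷ ts) (there p) | nothing = Product.map₁ there (∈-fvTs-absT⁻ ts p)
  ∈-fvTs-absT⁻ (bv i ∷ ts) p = ∈-fvTs-absT⁻ ts p
∈-fvF-absF⁻ f (A ⊗ B) p =
  [ Product.map₁ ∈-++⁺ˡ ∘ ∈-fvF-absF⁻ f A , Product.map₁ (∈-++⁺ʳ (fvF A)) ∘ ∈-fvF-absF⁻ f B ]′ (∈-++⁻ (fvF (absF f A)) p)
∈-fvF-absF⁻ f (A ⊸ B) p =
  [ Product.map₁ ∈-++⁺ˡ ∘ ∈-fvF-absF⁻ f A , Product.map₁ (∈-++⁺ʳ (fvF A)) ∘ ∈-fvF-absF⁻ f B ]′ (∈-++⁻ (fvF (absF f A)) p)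
∈-fvF-absF⁻ f (∃′ A) p = ∈-fvF-absF⁻ f A p
∈-fvF-absF⁻ f (∀′ A) p = ∈-fvF-absF⁻ f A p

maxPred : ∀ {n} → Fm n → ℕ
maxPred (at p ts) = p
maxPred (A ⊗ B) = maxPred A ⊔ maxPred B
maxPred (A ⊸ B) = maxPred A ⊔ maxPred B
maxPred (∃′ A) = maxPred A
maxPred (∀′ A) = maxPred A

maxPred-renF : ∀ {n} (h : Var → Var) (A : Fm n) → maxPred (renF h A) ≡ maxPred A
maxPred-renF h (at p ts) = refl
maxPred-renF h (A ⊗ B) = cong₂ _⊔_ (maxPred-renF h A) (maxPred-renF h B)
maxPred-renF h (A ⊸ B) = cong₂ _⊔_ (maxPred-renF h A) (maxPred-renF h B)
maxPred-renF h (∃′ A) = maxPred-renF h A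
maxPred-renF h (∀′ A) = maxPred-renF h A

maxPreds : List Form → ℕ
maxPreds = foldr (λ A m → maxPred A ⊔ m) 0

maxPred≤maxPreds : ∀ {A As} → A ∈ As → maxPred A ≤ maxPreds As
maxPred≤maxPreds {A} {_ ∷ As} (here refl) = m≤m⊔n (maxPred A) (maxPreds As)
maxPred≤maxPreds {A} {B ∷ As} (there p) = m≤n⇒m≤o⊔n (maxPred B) (maxPred≤maxPreds p)

fresh-renF : ∀ {r n} (h : Var → Var) (A : Fm n) → maxPred A < r → maxPred (renF h A) < r
fresh-renF {r} h A = subst (_< r) (sym (maxPred-renF h A))

-- Invariants of derivability

module PredicateSubstitution (r : ℕ) (W : ∀ {n} → List (Tm n) → Fm n)
  (instF-W : ∀ {m n} (σ : Fin m → Tm n) (ts : List (Tm m)) → instF σ (W ts) ≡ W (map (instT σ) ts))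
  (fvF-W : ∀ {n} (ts : List (Tm n)) → fvF (W ts) ⊆ concatMap fvT ts) where

  substPred : ∀ {n} → Fm n → Fm n
  substPred (at p ts) with p ≟ r
  ... | yes _ = W ts
  ... | no _ = at p ts
  substPred (A ⊗ B) = substPred A ⊗ substPred B
  substPred (A ⊸ B) = substPred A ⊸ substPred B
  substPred (∃′ A) = ∃′ (substPred A)
  substPred (∀′ A) = ∀′ (substPred A)

  substPred-r : ∀ {n} (ts : List (Tm n)) → substPred (at r ts) ≡ W ts
  substPred-r ts with r ≟ r
  ... | yes _ = refl
  ... | no r≢r = ⊥-elim (r≢r refl)

  substPred-fresh : ∀ {n} (A : Fm n) → maxPred A < r → substPred A ≡ A
  substPred-fresh (at p ts) p<r with p ≟ r
  ... | yes refl = ⊥-elim (<-irrefl refl p<r)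
  ... | no _ = refl
  substPred-fresh (A ⊗ B) lt = cong₂ _⊗_ (substPred-fresh A (m⊔n<o⇒m<o _ _ lt)) (substPred-fresh B (m⊔n<o⇒n<o _ _ lt))
  substPred-fresh (A ⊸ B) lt = cong₂ _⊸_ (substPred-fresh A (m⊔n<o⇒m<o _ _ lt)) (substPred-fresh B (m⊔n<o⇒n<o _ _ lt))
  substPred-fresh (∃′ A) lt = cong ∃′ (substPred-fresh A lt)
  substPred-fresh (∀′ A) lt = cong ∀′ (substPred-fresh A lt)

  substPred-instF : ∀ {m n} (σ : Fin m → Tm n) (A : Fm m) → substPred (instF σ A) ≡ instF σ (substPred A)
  substPred-instF σ (at p ts) with p ≟ r
  ... | yes _ = sym (instF-W σ ts)
  ... | no _ = refl
  substPred-instF σ (A ⊗ B) = cong₂ _⊗_ (substPred-instF σ A) (substPred-instF σ B)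
  substPred-instF σ (A ⊸ B) = cong₂ _⊸_ (substPred-instF σ A) (substPred-instF σ B)
  substPred-instF σ (∃′ A) = cong ∃′ (substPred-instF (liftσ σ) A)
  substPred-instF σ (∀′ A) = cong ∀′ (substPred-instF (liftσ σ) A)

  fvF-substPred : ∀ {n} (A : Fm n) → fvF (substPred A) ⊆ fvF A
  fvF-substPred (at p ts) with p ≟ r
  ... | yes _ = fvF-W ts
  ... | no _ = id
  fvF-substPred (A ⊗ B) = ++⁺ (fvF-substPred A) (fvF-substPred B)
  fvF-substPred (A ⊸ B) = ++⁺ (fvF-substPred A) (fvF-substPred B)
  fvF-substPred (∃′ A) = fvF-substPred A
  fvF-substPred (∀′ A) = fvF-substPred A

  fvL-substPred : ∀ Γ → fvL (map substPred Γ) ⊆ fvL Γ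
  fvL-substPred [] = id
  fvL-substPred (A ∷ Γ) = ++⁺ (fvF-substPred A) (fvL-substPred Γ)

  substPred-⊢ : ∀ {Γ C} → Γ ⊢ C → map substPred Γ ⊢ substPred C
  substPred-⊢ ax = ax
  substPred-⊢ (cut {Γ} {Δ} p q) = subst (_⊢ _) (sym (map-++ substPred Γ Δ)) (cut (substPred-⊢ p) (substPred-⊢ q))
  substPred-⊢ (exch π p) = exch (↭.map⁺ substPred π) (substPred-⊢ p)
  substPred-⊢ (⊗L p) = ⊗L (substPred-⊢ p)
  substPred-⊢ (⊗R {Γ} {Δ} p q) = subst (_⊢ _) (sym (map-++ substPred Γ Δ)) (⊗R (substPred-⊢ p) (substPred-⊢ q))
  substPred-⊢ (⊸L {Γ} {Δ} {A} {B} {C} p q) =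
    subst (_⊢ substPred C) (cong (substPred (A ⊸ B) ∷_) (sym (map-++ substPred Γ Δ))) (⊸L (substPred-⊢ p) (substPred-⊢ q))
  substPred-⊢ (⊸R p) = ⊸R (substPred-⊢ p)
  substPred-⊢ (∃L {Γ} {A} {C} y y∉ p) =
    ∃L y (y∉ ∘ fvL-substPred (C ∷ ∃′ A ∷ Γ)) (subst (λ F → F ∷ _ ⊢ _) (substPred-instF _ A) (substPred-⊢ p))
  substPred-⊢ (∃R {A = A} z p) = ∃R z (subst (_ ⊢_) (substPred-instF _ A) (substPred-⊢ p))
  substPred-⊢ (∀L {A = A} z p) = ∀L z (subst (λ F → F ∷ _ ⊢ _) (substPred-instF _ A) (substPred-⊢ p))
  substPred-⊢ (∀R {Γ} {A} y y∉ p) =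
    ∀R y (y∉ ∘ fvL-substPred (∀′ A ∷ Γ)) (subst (_ ⊢_) (substPred-instF _ A) (substPred-⊢ p))

module AtomCount (r : ℕ) where
  open +-*-Solver

  count : ∀ {n} → Fm n → ℤ
  count (at p ts) with p ≟ r
  ... | yes _ = + 1
  ... | no _ = + 0
  count (A ⊗ B) = count A +ℤ count B
  count (A ⊸ B) = count B - count A
  count (∃′ A) = count A
  count (∀′ A) = count A

  countL : List Form → ℤ
  countL [] = + 0
  countL (A ∷ Γ) = count A +ℤ countL Γ

  count-r : ∀ {n} (ts : List (Tm n)) → count (at r ts) ≡ + 1
  count-r ts with r ≟ r
  ... | yes _ = refl
  ... | no r≢r = ⊥-elim (r≢r refl)

  count-fresh : ∀ {n} (A : Fm n) → maxPred A < r → count A ≡ + 0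
  count-fresh (at p ts) p<r with p ≟ r
  ... | yes refl = ⊥-elim (<-irrefl refl p<r)
  ... | no _ = refl
  count-fresh (A ⊗ B) lt = cong₂ _+ℤ_ (count-fresh A (m⊔n<o⇒m<o _ _ lt)) (count-fresh B (m⊔n<o⇒n<o _ _ lt))
  count-fresh (A ⊸ B) lt = cong₂ _-_ (count-fresh B (m⊔n<o⇒n<o _ _ lt)) (count-fresh A (m⊔n<o⇒m<o _ _ lt))
  count-fresh (∃′ A) lt = count-fresh A lt
  count-fresh (∀′ A) lt = count-fresh A lt

  count-instF : ∀ {m n} (σ : Fin m → Tm n) (A : Fm m) → count (instF σ A) ≡ count A
  count-instF σ (at p ts) = refl
  count-instF σ (A ⊗ B) = cong₂ _+ℤ_ (count-instF σ A) (count-instF σ B)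
  count-instF σ (A ⊸ B) = cong₂ _-_ (count-instF σ B) (count-instF σ A)
  count-instF σ (∃′ A) = count-instF (liftσ σ) A
  count-instF σ (∀′ A) = count-instF (liftσ σ) A

  count-renF : ∀ {n} (h : Var → Var) (A : Fm n) → count (renF h A) ≡ count A
  count-renF h (at p ts) = refl
  count-renF h (A ⊗ B) = cong₂ _+ℤ_ (count-renF h A) (count-renF h B)
  count-renF h (A ⊸ B) = cong₂ _-_ (count-renF h B) (count-renF h A)
  count-renF h (∃′ A) = count-renF h A
  count-renF h (∀′ A) = count-renF h A

  countL-++ : ∀ Γ Δ → countL (Γ ++ Δ) ≡ countL Γ +ℤ countL Δ
  countL-++ [] Δ = solve 1 (λ d → d := con (+ 0) :+ d) refl (countL Δ)
  countL-++ (A ∷ Γ) Δ = trans (cong (count A +ℤ_) (countL-++ Γ Δ))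
    (solve 3 (λ a g d → a :+ (g :+ d) := (a :+ g) :+ d) refl (count A) (countL Γ) (countL Δ))

  countL-↭ : ∀ {Γ Δ} → Γ ↭ Δ → countL Γ ≡ countL Δ
  countL-↭ ↭.refl = refl
  countL-↭ (↭.prep A π) = cong (count A +ℤ_) (countL-↭ π)
  countL-↭ (↭.swap {ys = Δ} A B π) = trans (cong (λ z → count A +ℤ (count B +ℤ z)) (countL-↭ π))
    (solve 3 (λ a b d → a :+ (b :+ d) := b :+ (a :+ d)) refl (count A) (count B) (countL Δ))
  countL-↭ (↭.trans π ρ) = trans (countL-↭ π) (countL-↭ ρ)

  count-⊢ : ∀ {Γ C} → Γ ⊢ C → countL Γ ≡ count C
  count-⊢ (ax {A}) = solve 1 (λ a → a :+ con (+ 0) := a) refl (count A)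
  count-⊢ (cut {Γ} {Δ} p q) = trans (countL-++ Γ Δ) (trans (cong (_+ℤ countL Δ) (count-⊢ p)) (count-⊢ q))
  count-⊢ (exch π p) = trans (sym (countL-↭ π)) (count-⊢ p)
  count-⊢ (⊗L {Γ} {A} {B} p) =
    trans (solve 3 (λ a b g → (a :+ b) :+ g := a :+ (b :+ g)) refl (count A) (count B) (countL Γ)) (count-⊢ p)
  count-⊢ (⊗R {Γ} {Δ} p q) = trans (countL-++ Γ Δ) (cong₂ _+ℤ_ (count-⊢ p) (count-⊢ q))
  count-⊢ (⊸L {Γ} {Δ} {A} {B} p q) =
    trans (cong ((count B - count A) +ℤ_) (trans (countL-++ Γ Δ) (cong (_+ℤ countL Δ) (count-⊢ p))))
      (trans (solve 3 (λ a b d → (b :- a) :+ (a :+ d) := b :+ d) refl (count A) (count B) (countL Δ)) (count-⊢ q))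
  count-⊢ (⊸R {Γ} {A} p) =
    trans (solve 2 (λ a g → g := (a :+ g) :- a) refl (count A) (countL Γ)) (cong (_- count A) (count-⊢ p))
  count-⊢ (∃L {Γ} {A} y _ p) = trans (cong (_+ℤ countL Γ) (sym (count-instF _ A))) (count-⊢ p)
  count-⊢ (∃R {A = A} z p) = trans (count-⊢ p) (count-instF _ A)
  count-⊢ (∀L {Γ} {A} z p) = trans (cong (_+ℤ countL Γ) (sym (count-instF _ A))) (count-⊢ p)
  count-⊢ (∀R {A = A} y _ p) = trans (count-⊢ p) (count-instF _ A)

discharge : ∀ Γ {Ns C} → Γ ++ Ns ⊢ C → All ([] ⊢_) Ns → Γ ⊢ C
discharge Γ {[]} p [] = subst (_⊢ _) (++-identityʳ Γ) p
discharge Γ {N ∷ Ns} p (⊢N ∷ ⊢Ns) = discharge Γ (cut ⊢N (exch (shifts Γ (N ∷ [])) p)) ⊢Ns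

multicut : ∀ {Δs Γ C} → Pointwise _⊢_ Δs Γ → Γ ⊢ C → concat Δs ⊢ C
multicut = multicut-after []
  where
  multicut-after : ∀ Θ {Δs Γ C} → Pointwise _⊢_ Δs Γ → Θ ++ Γ ⊢ C → Θ ++ concat Δs ⊢ C
  multicut-after Θ [] p = p
  multicut-after Θ {Δ ∷ Δs} {F ∷ Γ} {C} (q ∷ qs) p =
    subst (_⊢ C) (++-assoc Θ Δ (concat Δs))
      (multicut-after (Θ ++ Δ) qs (subst (_⊢ C) (sym (++-assoc Θ Δ Γ))
        (exch (shifts Δ Θ) (cut q (exch (shifts Θ (F ∷ [])) p)))))

⊗L-mid : ∀ Θ {A B Ψ C} → Θ ++ A ∷ B ∷ Ψ ⊢ C → Θ ++ (A ⊗ B) ∷ Ψ ⊢ C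
⊗L-mid Θ {A} {B} p = exch (↭-sym (shifts Θ (_ ∷ []))) (⊗L (exch (shifts Θ (A ∷ B ∷ [])) p))

⊸-absorb : ∀ {B P R X Γ} → B ∷ P ∷ Γ ⊢ X → (P ⊗ (R ⊸ B)) ∷ Γ ⊢ R ⊸ X
⊸-absorb {B} {P} {R} {X} {Γ} p =
  ⊸R (exch (↭-swap _ _ ↭-refl) (⊗L (exch (shift P (R ⊸ B ∷ R ∷ []) Γ) (⊸L {Γ = R ∷ []} ax p))))

interleave : ∀ {n} → (Fin n → Form) → (Fin n → Form) → List Form
interleave f g = concat (tabulate (λ i → f i ∷ g i ∷ []))

interleave-↭ : ∀ {n} (f g : Fin n → Form) → interleave f g ↭ tabulate f ++ tabulate g
interleave-↭ {zero} f g = ↭-refl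
interleave-↭ {suc n} f g = ↭-prep (f zero)
  (↭-trans (↭-prep (g zero) (interleave-↭ (f ∘ suc) (g ∘ suc)))
    (↭-sym (shift (g zero) (tabulate (f ∘ suc)) (tabulate (g ∘ suc)))))

⊗L-interleave : ∀ {n} (f g : Fin n → Form) Θ {C} →
  Θ ++ interleave f g ⊢ C → Θ ++ tabulate (λ i → f i ⊗ g i) ⊢ C
⊗L-interleave {zero} f g Θ p = p
⊗L-interleave {suc n} f g Θ {C} p =
  ⊗L-mid Θ (subst (_⊢ C) (++-assoc Θ (f zero ∷ g zero ∷ []) _)
    (⊗L-interleave (f ∘ suc) (g ∘ suc) (Θ ++ f zero ∷ g zero ∷ [])
      (subst (_⊢ C) (sym (++-assoc Θ (f zero ∷ g zero ∷ []) _)) p)))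

pointwise⇒tabulate : ∀ {R : ℕ → Form → Set} {w As} → Pointwise R w As →
  ∃[ f ] As ≡ tabulate f × (∀ e → R (lookupL w e) (f e))
pointwise⇒tabulate [] = (λ ()) , refl , λ ()
pointwise⇒tabulate {w = a ∷ w} {A ∷ As} (r ∷ rs) with pointwise⇒tabulate rs
... | f , refl , rs′ = (λ { zero → A ; (suc e) → f e }) , refl , λ { zero → r ; (suc e) → rs′ e }

tabulate⇒pointwise : ∀ {R : ℕ → Form → Set} w (f : Fin (length w) → Form) → (∀ e → R (lookupL w e) (f e)) →
  Pointwise R w (tabulate f)
tabulate⇒pointwise [] f rs = []
tabulate⇒pointwise (a ∷ w) f rs = rs zero ∷ tabulate⇒pointwise w (f ∘ suc) (rs ∘ suc)

All-lookupL : ∀ {P : ℕ → Set} {w} → All P w → ∀ e → P (lookupL w e)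
All-lookupL (p ∷ ps) zero = p
All-lookupL (p ∷ ps) (suc e) = All-lookupL ps e

lookupL-All : ∀ {P : ℕ → Set} w → (∀ e → P (lookupL w e)) → All P w
lookupL-All [] h = []
lookupL-All (a ∷ w) h = h zero ∷ lookupL-All w (h ∘ suc)

strAnt-tabulate : ∀ k {n} (f : Fin n → Form) →
  strAnt k (tabulate f) ≡ tabulate (λ i → renF (st (k + toℕ i) (suc (k + toℕ i))) (f i))
strAnt-tabulate k {zero} f = refl
strAnt-tabulate k {suc n} f = cong₂ _∷_ (cong (λ m → renF (st m (suc m)) (f zero)) (sym (+-identityʳ k)))
  (trans (strAnt-tabulate (suc k) (f ∘ suc))
    (tabulate-cong λ i → cong (λ m → renF (st m (suc m)) (f (suc i))) (sym (+-suc k (toℕ i)))))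

subOn-∈ : ∀ xs (f : (σ : Var) → .(σ ∈ xs) → Var) v → (p : v ∈ xs) → subOn xs f v ≡ f v p
subOn-∈ xs f v p with v ∈? xs
... | yes _ = refl
... | no v∉xs = ⊥-elim (v∉xs p)

IsST : Var → Set
IsST x = x ≡ 𝐬 ⊎ x ≡ 𝐭

IsST⇒∈st : ∀ {x} → IsST x → x ∈ 𝐬 ∷ 𝐭 ∷ []
IsST⇒∈st (inj₁ refl) = here refl
IsST⇒∈st (inj₂ refl) = there (here refl)

∈st⇒IsST : ∀ {x} → x ∈ 𝐬 ∷ 𝐭 ∷ [] → IsST x
∈st⇒IsST (here refl) = inj₁ refl
∈st⇒IsST (there (here refl)) = inj₂ refl

-- The sequent in InL 𝒢 (sg type w), for the node formulas hV and edge formulas hE.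
SgSequent : (type : ℕ → List Var) (w : List ℕ) → (Fin (suc (length w)) → Form) → (Fin (length w) → Form) → Form → Set
SgSequent type w hV hE S =
  map (λ e → renF (subOn (type (lab e)) (λ σ p → toℕ (att e σ p))) (hE e)) (allFin nE)
    ++ map (λ v → renF (bul (toℕ v)) (hV v)) (allFin nV)
  ⊢ renF (subOn ty (λ σ p → toℕ (ext σ p))) S
  where open Hypergraph (sg type w)

module _ (type : ℕ → List Var) (w : List ℕ) where
  open Hypergraph (sg type w)

  renF-sg-att : ∀ e (A : Form) → (∀ x → x ∈ fvF A → x ∈ type (lookupL w e) × IsST x) →
    renF (subOn (type (lookupL w e)) (λ σ p → toℕ (att e σ p))) A ≡ renF (st (toℕ e) (suc (toℕ e))) A
  renF-sg-att e A fvA = renF-cong A λ x x∈A → on-att x (fvA x x∈A)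
    where
    on-att : ∀ x → x ∈ type (lookupL w e) × IsST x →
      subOn (type (lookupL w e)) (λ σ p → toℕ (att e σ p)) x ≡ st (toℕ e) (suc (toℕ e)) x
    on-att x (x∈ , inj₁ refl) = trans (subOn-∈ _ _ x x∈) (toℕ-inject₁ e)
    on-att x (x∈ , inj₂ refl) = subOn-∈ _ _ x x∈

  renF-sg-ext : ∀ (A : Form) → (∀ x → x ∈ fvF A → IsST x) →
    renF (subOn ty (λ σ p → toℕ (ext σ p))) A ≡ renF (st 0 (length w)) A
  renF-sg-ext A fvA = renF-cong A λ x x∈A → on-ext x (fvA x x∈A)
    where
    on-ext : ∀ x → IsST x → subOn ty (λ σ p → toℕ (ext σ p)) x ≡ st 0 (length w) x
    on-ext x (inj₁ refl) = refl
    on-ext x (inj₂ refl) = toℕ-fromℕ (length w)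

  sgSequent≡ : ∀ hV hE S → (∀ e x → x ∈ fvF (hE e) → x ∈ type (lookupL w e) × IsST x) → (∀ x → x ∈ fvF S → IsST x) →
    SgSequent type w hV hE S
      ≡ (strAnt 0 (tabulate hE) ++ tabulate (λ v → renF (bul (toℕ v)) (hV v)) ⊢ renF (st 0 (length w)) S)
  sgSequent≡ hV hE S fvE fvS = cong₂ _⊢_ (cong₂ _++_ edges (map-tabulate id _)) (renF-sg-ext S fvS)
    where
    edges = trans (map-tabulate id _)
      (trans (tabulate-cong λ e → renF-sg-att e (hE e) (fvE e)) (sym (strAnt-tabulate 0 hE)))

-- From string grammars to hypergraph grammars

abstract-st : Var → Maybe (Fin 2)
abstract-st 0 = just zero
abstract-st 1 = just (suc zero)
abstract-st (suc (suc _)) = nothing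

module IdentityClosure (S : Form) (fvS : ∀ x → x ∈ fvF S → IsST x) where

  idBody : Fm 2
  idBody = absF abstract-st S ⊸ absF abstract-st S

  -- ∀𝐭 ∀𝐬 (S ⊸ S)
  idClosure : Form
  idClosure = ∀′ (∀′ idBody)

  absS-closed : ∀ x → x ∉ fvF (absF {0} abstract-st S)
  absS-closed x x∈ with ∈-fvF-absF⁻ abstract-st S x∈
  ... | x∈S , eq with fvS x x∈S | eq
  ... | inj₁ refl | ()
  ... | inj₂ refl | ()

  idBody-closed : ∀ x → x ∉ fvF idBody
  idBody-closed x x∈ = [ absS-closed x , absS-closed x ]′ (∈-++⁻ (fvF (absF {0} abstract-st S)) x∈)

  ⊢idClosure : [] ⊢ idClosure
  ⊢idClosure = ∀R 0 (idBody-closed 0 ∘ subst (0 ∈_) (++-identityʳ (fvF idBody)))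
    (∀R 1 1-fresh (⊸R ax))
    where
    1-fresh : 1 ∉ fvL (∀′ (instF (liftσ (λ _ → fv 0)) idBody) ∷ [])
    1-fresh p with ∈-fvF-instF⁻ (liftσ (λ _ → fv 0)) idBody (subst (1 ∈_) (++-identityʳ _) p)
    ... | inj₁ q = idBody-closed 1 q
    ... | inj₂ s with freeIn-liftσ (λ _ → fv 0) s
    ... | _ , here ()

  open-idClosure : ∀ u z → instF (λ _ → fv u) (instF (liftσ {1} {0} (λ _ → fv z)) (absF {0} abstract-st S)) ≡ renF (st u z) S
  open-idClosure u z = trans (instF-∘ {ρ′ = ρ} opening (absF {0} abstract-st S)) (instF-absF₀ abstract-st (st u z) I S)
    where
    ρ : Fin 2 → Tm 0
    ρ zero = fv u
    ρ (suc zero) = fv z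
    opening : instT (λ _ → fv u) ∘ liftσ (λ _ → fv z) ≗ ρ
    opening zero = refl
    opening (suc zero) = refl
    I : AbsInstance abstract-st (st u z) {0} ρ (λ ())
    AbsInstance.on-bound I ()
    AbsInstance.on-abstracted I 0 .zero refl = refl
    AbsInstance.on-abstracted I 1 .(suc zero) refl = refl
    AbsInstance.on-free I (suc (suc y)) _ = refl

  idClosure-unit : ∀ u z {Γ} → Γ ⊢ renF (st u z) S → idClosure ∷ Γ ⊢ renF (st u z) S
  idClosure-unit u z {Γ} p =
    ∀L z (∀L u (subst (λ F → (F ⊸ F) ∷ Γ ⊢ renF (st u z) S) (sym (open-idClosure u z))
      (subst (λ Δ → _ ∷ Δ ⊢ renF (st u z) S) (++-identityʳ Γ) (⊸L {Γ = Γ} {Δ = []} p ax))))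

module FromStringGrammar (G : StrGrammar) where
  open StrGrammar G

  q : ℕ
  q = suc (maxPred S ⊔ maxPreds (map proj₂ rel))

  rel-fresh : ∀ {a A} → (a , A) ∈ rel → maxPred A < q
  rel-fresh p = s≤s (m≤n⇒m≤o⊔n (maxPred S) (maxPred≤maxPreds (∈-map⁺ proj₂ p)))

  S-fresh : maxPred S < q
  S-fresh = s≤s (m≤m⊔n (maxPred S) _)

  Q : Form
  Q = at q []

  loop : Form
  loop = Q ⊸ Q

  typeST : ℕ → List Var
  typeST _ = 𝐬 ∷ 𝐭 ∷ []

  𝒢 : HGrammar
  𝒢 = record
    { T = T ; type = typeST ; S = loop ⊗ S ; X = 𝐬 ∷ 𝐭 ∷ [] ; rel = rel ; brel = loop ∷ []
    ; S-fv = λ x p → IsST⇒∈st (S-fv x p)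
    ; rel-T = rel-T
    ; rel-fv = λ p x m → IsST⇒∈st (rel-fv p x m)
    ; brel-fv = λ { (here refl) x () } }

  loop-chain : ∀ Γ → All (_≡ loop) Γ → Q ∷ Γ ⊢ Q
  loop-chain [] [] = ax
  loop-chain (_ ∷ Γ) (refl ∷ Γ≡) = exch (↭-swap _ _ ↭-refl) (⊸L {Γ = Q ∷ []} ax (loop-chain Γ Γ≡))

  open IdentityClosure S S-fv

  idScheme : ∀ {n} → List (Tm n) → Fm n
  idScheme _ = instF (λ ()) idClosure

  fvF-idScheme : ∀ {n} (ts : List (Tm n)) → fvF (idScheme ts) ⊆ concatMap fvT ts
  fvF-idScheme _ {x} x∈ with ∈-fvF-instF⁻ (λ ()) idClosure x∈
  ... | inj₁ x∈V = ⊥-elim (idBody-closed x x∈V)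
  ... | inj₂ (() , _)

  open PredicateSubstitution q idScheme (λ σ _ → instF-∘ (λ ()) idClosure) fvF-idScheme

  loop-elim : ∀ {Γ u z} → All (λ A → maxPred A < q) Γ → Γ ⊢ loop ⊗ renF (st u z) S → Γ ⊢ renF (st u z) S
  loop-elim {Γ} {u} {z} Γ-fresh p = subst (_⊢ X) (++-identityʳ Γ) (cut p′ unit)
    where
    X = renF (st u z) S
    p′ : Γ ⊢ (idClosure ⊸ idClosure) ⊗ X
    p′ = subst₂ _⊢_ (map-id-local (All.map (substPred-fresh _) Γ-fresh))
      (cong₂ (λ V Y → (V ⊸ V) ⊗ Y) (trans (substPred-r []) (instF-identity (λ ()) idClosure))
        (substPred-fresh X (fresh-renF (st u z) S S-fresh)))
      (substPred-⊢ p)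
    unit : (idClosure ⊸ idClosure) ⊗ X ∷ [] ⊢ X
    unit = ⊗L (⊸L {Γ = []} ⊢idClosure (idClosure-unit u z ax))

  fvF-rel : ∀ w (hE : Fin (length w) → Form) → (∀ e → (lookupL w e , hE e) ∈ rel) →
    ∀ e x → x ∈ fvF (hE e) → x ∈ typeST (lookupL w e) × IsST x
  fvF-rel w hE hE∈ e x x∈ = IsST⇒∈st (rel-fv (hE∈ e) x x∈) , rel-fv (hE∈ e) x x∈

  node-provable : ∀ {N} v → N ∈ loop ∷ [] → [] ⊢ renF (bul v) N
  node-provable v (here refl) = ⊸R ax

  lStr⇒generates : ∀ w → LStr 𝒢 w → Generates G w
  lStr⇒generates w (_ , _ , _ , hV , hE , hV∈ , hE∈ , p) =
    tabulate hE , tabulate⇒pointwise w hE hE∈ ,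
    loop-elim edges-fresh (discharge _ p′ (tabulate⁺ λ v → node-provable (toℕ v) (hV∈ v)))
    where
    p′ = subst id (sgSequent≡ typeST w hV hE (loop ⊗ S) (fvF-rel w hE hE∈) S-fv) p
    edges-fresh : All (λ A → maxPred A < q) (strAnt 0 (tabulate hE))
    edges-fresh = subst (All _) (sym (strAnt-tabulate 0 hE)) (tabulate⁺ λ e → fresh-renF _ (hE e) (rel-fresh (hE∈ e)))

  generates⇒lStr : ∀ w → Generates G w → LStr 𝒢 w
  generates⇒lStr w (As , As∼w , p) with pointwise⇒tabulate As∼w
  ... | hE , refl , hE∈ = lookupL-All w (λ _ σ → ∈st⇒IsST , IsST⇒∈st) , rel-T ∘ hE∈ , (λ σ → id , id) ,
    (λ _ → loop) , hE , (λ _ → here refl) , hE∈ ,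
    subst id (sym (sgSequent≡ typeST w (λ _ → loop) hE (loop ⊗ S) (fvF-rel w hE hE∈) S-fv))
      (exch (++-comm (tabulate {n = suc (length w)} λ _ → loop) _) (⊗R (⊸R (loop-chain _ (tabulate⁺ λ _ → refl))) p))

  lStr≐generates : LStr 𝒢 ≐ Generates G
  lStr≐generates w = lStr⇒generates w , generates⇒lStr w

-- From hypergraph grammars to string grammars

IsSTSet : List Var → Set
IsSTSet xs = All IsST xs × 𝐬 ∈ xs × 𝐭 ∈ xs

isSTSet? : ∀ xs → Dec (IsSTSet xs)
isSTSet? xs = all? (λ σ → (σ ≟ 𝐬) ⊎-dec (σ ≟ 𝐭)) xs ×-dec (𝐬 ∈? xs) ×-dec (𝐭 ∈? xs)

IsSTSet⇒HasTypeST : ∀ {type a} → IsSTSet (type a) → HasTypeST type a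
IsSTSet⇒HasTypeST (all , 𝐬∈ , 𝐭∈) σ = All.lookup all , λ { (inj₁ refl) → 𝐬∈ ; (inj₂ refl) → 𝐭∈ }

HasTypeST⇒IsSTSet : ∀ {type a} → HasTypeST type a → IsSTSet (type a)
HasTypeST⇒IsSTSet h = All.tabulate (λ {σ} → proj₁ (h σ)) , proj₂ (h 𝐬) (inj₁ refl) , proj₂ (h 𝐭) (inj₂ refl)

renF-bul : ∀ (N : Form) → (∀ x → x ∈ fvF N → x ≡ x•) → ∀ (h : Var → Var) c → renF h (renF (bul c) N) ≡ renF (bul (h c)) N
renF-bul N fvN h c = trans (renF-∘ N) (renF-cong N λ x x∈ → on-x• (fvN x x∈))
  where
  on-x• : ∀ {x} → x ≡ x• → h (bul c x) ≡ bul (h c) x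
  on-x• refl = refl

weight : ∀ {A : Set} → Maybe A → ℕ
weight nothing = 0
weight (just _) = 1

totalWeight : ∀ {A : Set} {n} → (Fin n → Maybe A) → ℕ
totalWeight m = sum (tabulate (weight ∘ m))

totalWeight≡0 : ∀ {A : Set} {n} (m : Fin n → Maybe A) → totalWeight m ≡ 0 → ∀ e → m e ≡ nothing
totalWeight≡0 m eq zero with m zero
... | nothing = refl
totalWeight≡0 m eq (suc e) with m zero
... | nothing = totalWeight≡0 (m ∘ suc) eq e

totalWeight≡1 : ∀ {A : Set} {n} (m : Fin n → Maybe A) → totalWeight m ≡ 1 →
  ∃[ e ] ∃[ x ] m e ≡ just x × (∀ e′ → Maybe.All (_≡ x) (m e′))
totalWeight≡1 {n = suc n} m eq with m zero in m0
... | just x = zero , x , m0 , only-x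
  where
  only-x : ∀ e′ → Maybe.All (_≡ x) (m e′)
  only-x zero rewrite m0 = Maybe.just refl
  only-x (suc e′) rewrite totalWeight≡0 (m ∘ suc) (suc-injective eq) e′ = Maybe.nothing
... | nothing with totalWeight≡1 (m ∘ suc) eq
... | e , x , me , only-x = suc e , x , me , λ { zero → subst (Maybe.All _) (sym m0) Maybe.nothing ; (suc e′) → only-x e′ }

abstract-x• : Var → Maybe (Fin 1)
abstract-x• 2 = just zero
abstract-x• 0 = nothing
abstract-x• 1 = nothing
abstract-x• (suc (suc (suc _))) = nothing

module ToStringGrammar (𝒢 : HGrammar) where
  open HGrammar 𝒢

  r : ℕ
  r = suc (maxPred S ⊔ (maxPreds (map proj₂ rel) ⊔ maxPreds brel))

  rel-fresh : ∀ {a A} → (a , A) ∈ rel → maxPred A < r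
  rel-fresh p = s≤s (m≤n⇒m≤o⊔n (maxPred S) (m≤n⇒m≤n⊔o (maxPreds brel) (maxPred≤maxPreds (∈-map⁺ proj₂ p))))

  brel-fresh : ∀ {N} → N ∈ brel → maxPred N < r
  brel-fresh p = s≤s (m≤n⇒m≤o⊔n (maxPred S) (m≤n⇒m≤o⊔n (maxPreds (map proj₂ rel)) (maxPred≤maxPreds p)))

  S-fresh : maxPred S < r
  S-fresh = s≤s (m≤m⊔n (maxPred S) _)

  relST : List (ℕ × Form)
  relST = filter (isSTSet? ∘ type ∘ proj₁) rel

  relST⁻ : ∀ {a A} → (a , A) ∈ relST → (a , A) ∈ rel × IsSTSet (type a)
  relST⁻ = ∈-filter⁻ (isSTSet? ∘ type ∘ proj₁)

  relST⁺ : ∀ {a A} → (a , A) ∈ rel → IsSTSet (type a) → (a , A) ∈ relST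
  relST⁺ = ∈-filter⁺ (isSTSet? ∘ type ∘ proj₁)

  R : Var → Form
  R y = at r (fv y ∷ [])

  -- N is the formula of the target node of the edge; just N₀ marks the letter that also supplies the first node.
  strFormula : Form → Form → Maybe Form → Form
  strFormula A N nothing = A ⊗ renF (bul 𝐭) N
  strFormula A N (just N₀) = (A ⊗ renF (bul 𝐭) N) ⊗ (R 𝐬 ⊸ renF (bul 𝐬) N₀)

  startOptions : List (Maybe Form)
  startOptions = nothing ∷ map just brel

  entriesFor : ℕ × Form → List (ℕ × Form)
  entriesFor (a , A) = concatMap (λ N → map (λ m → a , strFormula A N m) startOptions) brel

  strRel : List (ℕ × Form)
  strRel = concatMap entriesFor relST

  record StrRelEntry (a : ℕ) (F : Form) : Set where
    field
      A : Form
      N : Form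
      m : Maybe Form
      A∈ : (a , A) ∈ relST
      N∈ : N ∈ brel
      m∈ : Maybe.All (_∈ brel) m
      F≡ : F ≡ strFormula A N m

  decode : ∀ {a F} → (a , F) ∈ strRel → StrRelEntry a F
  decode p with find (∈-concatMap⁻ entriesFor p)
  ... | (a , A) , A∈ , q with find (∈-concatMap⁻ _ q)
  ... | N , N∈ , q′ with ∈-map⁻ (λ m → a , strFormula A N m) q′
  ... | m , m∈ , refl = record { A = A ; N = N ; m = m ; A∈ = A∈ ; N∈ = N∈ ; m∈ = option m∈ ; F≡ = refl }
    where
    option : ∀ {m} → m ∈ startOptions → Maybe.All (_∈ brel) m
    option (here refl) = Maybe.nothing
    option (there m∈) with ∈-map⁻ just m∈
    ... | N₀ , N₀∈ , refl = Maybe.just N₀∈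

  encode : ∀ {a A N m} → (a , A) ∈ relST → N ∈ brel → Maybe.All (_∈ brel) m → (a , strFormula A N m) ∈ strRel
  encode A∈ N∈ m∈ = ∈-concatMap⁺ entriesFor (lose A∈ (∈-concatMap⁺ _ (lose N∈ (∈-map⁺ _ (option m∈)))))
    where
    option : ∀ {m} → Maybe.All (_∈ brel) m → m ∈ startOptions
    option Maybe.nothing = here refl
    option (Maybe.just N₀∈) = there (∈-map⁺ just N₀∈)

  fvF-bul : ∀ {N c x} → N ∈ brel → x ∈ fvF (renF (bul c) N) → x ≡ c
  fvF-bul {N} {c} N∈ x∈ with ∈-fvF-renF⁻ (bul c) N x∈
  ... | y , y∈ , refl with brel-fv N∈ y y∈
  ... | refl = refl

  fvF-relST : ∀ {a A x} → (a , A) ∈ relST → x ∈ fvF A → x ∈ type a × IsST x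
  fvF-relST A∈ x∈ = let x∈type = rel-fv (proj₁ (relST⁻ A∈)) _ x∈ in x∈type , All.lookup (proj₁ (proj₂ (relST⁻ A∈))) x∈type

  fvF-edge : ∀ {a A N x} → (a , A) ∈ relST → N ∈ brel → x ∈ fvF (strFormula A N nothing) → IsST x
  fvF-edge {A = A} A∈ N∈ x∈ = [ proj₂ ∘ fvF-relST A∈ , inj₂ ∘ fvF-bul N∈ ]′ (∈-++⁻ (fvF A) x∈)

  fvF-strFormula : ∀ {a A N x} m → (a , A) ∈ relST → N ∈ brel → Maybe.All (_∈ brel) m → x ∈ fvF (strFormula A N m) → IsST x
  fvF-strFormula nothing A∈ N∈ _ = fvF-edge A∈ N∈
  fvF-strFormula {A = A} {N} (just N₀) A∈ N∈ (Maybe.just N₀∈) x∈ with ∈-++⁻ (fvF (strFormula A N nothing)) x∈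
  ... | inj₁ q = fvF-edge A∈ N∈ q
  ... | inj₂ (here refl) = inj₁ refl
  ... | inj₂ (there q) = inj₁ (fvF-bul N₀∈ q)

  edge-fresh : ∀ {a A N} → (a , A) ∈ relST → N ∈ brel → maxPred (strFormula A N nothing) < r
  edge-fresh {N = N} A∈ N∈ = ⊔-lub (rel-fresh (proj₁ (relST⁻ A∈))) (fresh-renF (bul 𝐭) N (brel-fresh N∈))

  renF-edge : ∀ h {A N} → N ∈ brel → renF h (strFormula A N nothing) ≡ renF h A ⊗ renF (bul (h 𝐭)) N
  renF-edge h {A} {N} N∈ = cong (renF h A ⊗_) (renF-bul N (brel-fv N∈) h 𝐭)

  open AtomCount r

  count-strFormula : ∀ {a A N} m → (a , A) ∈ relST → N ∈ brel → Maybe.All (_∈ brel) m →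
    count (strFormula A N m) ≡ - (+ weight m)
  count-strFormula {A = A} {N} nothing A∈ N∈ _ = count-fresh (strFormula A N nothing) (edge-fresh A∈ N∈)
  count-strFormula {A = A} {N} (just N₀) A∈ N∈ (Maybe.just N₀∈) =
    cong₂ _+ℤ_ (count-fresh (strFormula A N nothing) (edge-fresh A∈ N∈))
      (cong₂ _-_ (count-fresh (renF (bul 𝐬) N₀) (fresh-renF (bul 𝐬) N₀ (brel-fresh N₀∈))) (count-r {0} (fv 𝐬 ∷ [])))

  countL-tabulate : ∀ {n} (h : Fin n → Var → Var) (F : Fin n → Form) (m : Fin n → Maybe Form) →
    (∀ i → count (F i) ≡ - (+ weight (m i))) → countL (tabulate (λ i → renF (h i) (F i))) ≡ - (+ totalWeight m)
  countL-tabulate {zero} h F m eq = refl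
  countL-tabulate {suc n} h F m eq =
    trans (cong₂ _+ℤ_ (trans (count-renF (h zero) (F zero)) (eq zero)) (countL-tabulate (h ∘ suc) (F ∘ suc) (m ∘ suc) (eq ∘ suc)))
      (trans (sym (neg-distrib-+ (+ weight (m zero)) (+ totalWeight (m ∘ suc)))) (cong -_ (sym (pos-+ (weight (m zero)) _))))

  module StartSubstitution (N₀ : Form) (N₀∈ : N₀ ∈ brel) where

    N₀-scheme : Fm 1
    N₀-scheme = absF abstract-x• N₀

    -- R only occurs with one argument, so the value at [] is irrelevant.
    W : ∀ {n} → List (Tm n) → Fm n
    W [] = at r []
    W (t ∷ _) = instF (λ _ → t) N₀-scheme

    instF-W : ∀ {m n} (σ : Fin m → Tm n) (ts : List (Tm m)) → instF σ (W ts) ≡ W (map (instT σ) ts)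
    instF-W σ [] = refl
    instF-W σ (t ∷ ts) = instF-∘ (λ _ → refl) N₀-scheme

    fvF-W : ∀ {n} (ts : List (Tm n)) → fvF (W ts) ⊆ concatMap fvT ts
    fvF-W (t ∷ ts) x∈ with ∈-fvF-instF⁻ (λ _ → t) N₀-scheme x∈
    ... | inj₂ (_ , x∈t) = ∈-++⁺ˡ x∈t
    ... | inj₁ x∈N with ∈-fvF-absF⁻ abstract-x• N₀ x∈N
    ... | x∈N₀ , eq with brel-fv N₀∈ _ x∈N₀ | eq
    ... | refl | ()

    open PredicateSubstitution r W instF-W fvF-W public

    substPred-R : ∀ y → substPred (R y) ≡ renF (bul y) N₀
    substPred-R y = trans (substPred-r (fv y ∷ [])) (instF-absF₀ abstract-x• (bul y) I N₀)
      where
      I : AbsInstance abstract-x• (bul y) {0} (λ _ → fv y) (λ ())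
      AbsInstance.on-bound I ()
      AbsInstance.on-abstracted I 2 zero refl = refl
      AbsInstance.on-free I 0 _ = refl
      AbsInstance.on-free I 1 _ = refl
      AbsInstance.on-free I (suc (suc (suc _))) _ = refl

    unpack : ∀ h {a A N m} → (a , A) ∈ relST → N ∈ brel → Maybe.All (_≡ N₀) m →
      renF h A ∷ renF (bul (h 𝐭)) N ∷ [] ⊢ substPred (renF h (strFormula A N m))
    unpack h {A = A} {N} A∈ N∈ Maybe.nothing =
      subst (renF h A ∷ renF (bul (h 𝐭)) N ∷ [] ⊢_) (sym eq) (⊗R ax ax)
      where
      eq : substPred (renF h (strFormula A N nothing)) ≡ renF h A ⊗ renF (bul (h 𝐭)) N
      eq = trans (substPred-fresh _ (fresh-renF h (strFormula A N nothing) (edge-fresh A∈ N∈))) (renF-edge h N∈)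
    unpack h {A = A} {N} A∈ N∈ (Maybe.just refl) =
      subst (renF h A ∷ renF (bul (h 𝐭)) N ∷ [] ⊢_) (sym eq) (⊗R {Δ = []} (⊗R ax ax) (⊸R ax))
      where
      eq : substPred (renF h (strFormula A N (just N₀)))
         ≡ (renF h A ⊗ renF (bul (h 𝐭)) N) ⊗ (renF (bul (h 𝐬)) N₀ ⊸ renF (bul (h 𝐬)) N₀)
      eq = cong₂ _⊗_ (trans (substPred-fresh _ (fresh-renF h (strFormula A N nothing) (edge-fresh A∈ N∈))) (renF-edge h N∈))
        (cong₂ _⊸_ (substPred-R (h 𝐬))
          (trans (substPred-fresh _ (fresh-renF h (renF (bul 𝐬) N₀) (fresh-renF (bul 𝐬) N₀ (brel-fresh N₀∈))))
            (renF-bul N₀ (brel-fv N₀∈) h 𝐬)))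

  module OfSTType (X-st : IsSTSet X) where

    S-st : ∀ x → x ∈ fvF S → IsST x
    S-st x x∈ = All.lookup (proj₁ X-st) (S-fv x x∈)

    G′ : StrGrammar
    G′ = record
      { T = T ; S = R 𝐬 ⊸ S ; rel = strRel
      ; S-fv = λ { x (here refl) → inj₁ refl ; x (there x∈) → S-st x x∈ }
      ; rel-T = λ p → rel-T (proj₁ (relST⁻ (StrRelEntry.A∈ (decode p))))
      ; rel-fv = strRel-fv }
      where
      strRel-fv : ∀ {a F} → (a , F) ∈ strRel → ∀ x → x ∈ fvF F → IsST x
      strRel-fv p x x∈ with decode p
      ... | record { m = m ; A∈ = A∈ ; N∈ = N∈ ; m∈ = m∈ ; F≡ = refl } = fvF-strFormula m A∈ N∈ m∈ x∈

    X≈st : ∀ σ → (σ ∈ 𝐬 ∷ 𝐭 ∷ [] → σ ∈ X) × (σ ∈ X → σ ∈ 𝐬 ∷ 𝐭 ∷ [])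
    X≈st σ = (λ { (here refl) → proj₁ (proj₂ X-st) ; (there (here refl)) → proj₂ (proj₂ X-st) }) ,
             IsST⇒∈st ∘ All.lookup (proj₁ X-st)

    sgSequent≡tabulate : ∀ w hV hE → (∀ e → (lookupL w e , hE e) ∈ relST) →
      SgSequent type w hV hE S
        ≡ (tabulate (λ i → renF (st (toℕ i) (suc (toℕ i))) (hE i)) ++ tabulate (λ v → renF (bul (toℕ v)) (hV v))
           ⊢ renF (st 0 (length w)) S)
    sgSequent≡tabulate w hV hE A∈ =
      trans (sgSequent≡ type w hV hE S (λ e x → fvF-relST (A∈ e)) S-st) (cong (λ Γ → Γ ++ _ ⊢ _) (strAnt-tabulate 0 hE))

    lStr⇒generates : ∀ w → minusε (LStr 𝒢) w → Generates G′ w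
    lStr⇒generates [] (_ , w≢ε) = ⊥-elim (w≢ε refl)
    lStr⇒generates w@(_ ∷ _) ((w-st , _ , _ , hV , hE , hV∈ , hE∈ , p) , _) =
      tabulate F , tabulate⇒pointwise w F F∈ ,
      subst (_⊢ R 0 ⊸ renF (st 0 (length w)) S) (sym ants≡)
        (⊸-absorb (⊗L-interleave a (b ∘ suc) (b zero ∷ []) (exch perm p′)))
      where
      m : Fin (length w) → Maybe Form
      m zero = just (hV zero)
      m (suc _) = nothing
      F : Fin (length w) → Form
      F e = strFormula (hE e) (hV (suc e)) (m e)
      A∈ : ∀ e → (lookupL w e , hE e) ∈ relST
      A∈ e = relST⁺ (hE∈ e) (HasTypeST⇒IsSTSet {type} (All-lookupL w-st e))
      m∈ : ∀ e → Maybe.All (_∈ brel) (m e)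
      m∈ zero = Maybe.just (hV∈ zero)
      m∈ (suc _) = Maybe.nothing
      F∈ : ∀ e → (lookupL w e , F e) ∈ strRel
      F∈ e = encode (A∈ e) (hV∈ (suc e)) (m∈ e)
      a : Fin (length w) → Form
      a i = renF (st (toℕ i) (suc (toℕ i))) (hE i)
      b : Fin (suc (length w)) → Form
      b v = renF (bul (toℕ v)) (hV v)
      p′ : tabulate a ++ tabulate b ⊢ renF (st 0 (length w)) S
      p′ = subst id (sgSequent≡tabulate w hV hE A∈) p
      perm : tabulate a ++ tabulate b ↭ b zero ∷ interleave a (b ∘ suc)
      perm = ↭-trans (shift (b zero) (tabulate a) _) (↭-prep (b zero) (↭-sym (interleave-↭ a (b ∘ suc))))
      G : Fin (length w) → Form
      G zero = (a zero ⊗ b (suc zero)) ⊗ (R 0 ⊸ b zero)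
      G (suc i) = a (suc i) ⊗ b (suc (suc i))
      renF-F : ∀ i → renF (st (toℕ i) (suc (toℕ i))) (F i) ≡ G i
      renF-F zero = cong₂ _⊗_ (renF-edge _ (hV∈ (suc zero))) (cong (R 0 ⊸_) (renF-bul (hV zero) (brel-fv (hV∈ zero)) _ 𝐬))
      renF-F (suc i) = renF-edge _ (hV∈ (suc (suc i)))
      ants≡ : strAnt 0 (tabulate F) ≡ tabulate G
      ants≡ = trans (strAnt-tabulate 0 F) (tabulate-cong renF-F)

    module FromDerivation (w : List ℕ) (F : Fin (length w) → Form) (F∈ : ∀ e → (lookupL w e , F e) ∈ strRel)
      (p : strAnt 0 (tabulate F) ⊢ R 0 ⊸ renF (st 0 (length w)) S) where

      X′ : Form
      X′ = renF (st 0 (length w)) S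

      entry : ∀ e → StrRelEntry (lookupL w e) (F e)
      entry e = decode (F∈ e)

      hE hN : Fin (length w) → Form
      hE = StrRelEntry.A ∘ entry
      hN = StrRelEntry.N ∘ entry

      m : Fin (length w) → Maybe Form
      m = StrRelEntry.m ∘ entry

      A∈ : ∀ e → (lookupL w e , hE e) ∈ relST
      A∈ = StrRelEntry.A∈ ∘ entry

      exactly-one-start : totalWeight m ≡ 1
      exactly-one-start = +-injective (neg-injective (begin
        - (+ totalWeight m)                                               ≡⟨ countL-tabulate _ F m count-F ⟨
        countL (tabulate (λ i → renF (st (toℕ i) (suc (toℕ i))) (F i))) ≡⟨ cong countL (strAnt-tabulate 0 F) ⟨
        countL (strAnt 0 (tabulate F))                                    ≡⟨ count-⊢ p ⟩
        count X′ - count (R 0)                                            ≡⟨ cong₂ _-_ X′-fresh (count-r {0} (fv 0 ∷ [])) ⟩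
        - (+ 1)                                                           ∎))
        where
        open ≡-Reasoning
        X′-fresh = count-fresh X′ (fresh-renF _ S S-fresh)
        count-F : ∀ e → count (F e) ≡ - (+ weight (m e))
        count-F e = trans (cong count (StrRelEntry.F≡ (entry e)))
          (count-strFormula (m e) (A∈ e) (StrRelEntry.N∈ (entry e)) (StrRelEntry.m∈ (entry e)))

      w≢ε : w ≡ [] → ⊥
      w≢ε refl with exactly-one-start
      ... | ()

      unique-start : ∃[ e ] ∃[ N ] m e ≡ just N × (∀ e′ → Maybe.All (_≡ N) (m e′))
      unique-start = totalWeight≡1 m exactly-one-start

      N₀ : Form
      N₀ = proj₁ (proj₂ unique-start)

      only-N₀ : ∀ e → Maybe.All (_≡ N₀) (m e)
      only-N₀ = proj₂ (proj₂ (proj₂ unique-start))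

      N₀∈ : N₀ ∈ brel
      N₀∈ = Maybe.drop-just (subst (Maybe.All _) (proj₁ (proj₂ (proj₂ unique-start))) (StrRelEntry.m∈ (entry (proj₁ unique-start))))

      open StartSubstitution N₀ N₀∈

      hV : Fin (suc (length w)) → Form
      hV zero = N₀
      hV (suc e) = hN e

      hV∈ : ∀ v → hV v ∈ brel
      hV∈ zero = N₀∈
      hV∈ (suc e) = StrRelEntry.N∈ (entry e)

      a : Fin (length w) → Form
      a i = renF (st (toℕ i) (suc (toℕ i))) (hE i)

      b : Fin (suc (length w)) → Form
      b v = renF (bul (toℕ v)) (hV v)

      substituted : tabulate (λ i → substPred (renF (st (toℕ i) (suc (toℕ i))) (F i))) ⊢ b zero ⊸ X′
      substituted = subst₂ _⊢_ (trans (cong (map substPred) (strAnt-tabulate 0 F)) (map-tabulate _ substPred))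
        (cong₂ _⊸_ (substPred-R 0) (substPred-fresh X′ (fresh-renF _ S S-fresh)))
        (substPred-⊢ p)

      unpacked : interleave a (b ∘ suc) ⊢ b zero ⊸ X′
      unpacked = multicut (Pointwise.tabulate⁺ unpack-F) substituted
        where
        unpack-F : ∀ i → a i ∷ b (suc i) ∷ [] ⊢ substPred (renF (st (toℕ i) (suc (toℕ i))) (F i))
        unpack-F i = subst (λ G → a i ∷ b (suc i) ∷ [] ⊢ substPred (renF _ G)) (sym (StrRelEntry.F≡ (entry i)))
          (unpack _ (A∈ i) (StrRelEntry.N∈ (entry i)) (only-N₀ i))

      hypergraph-derivation : tabulate a ++ tabulate b ⊢ X′
      hypergraph-derivation = exch perm (cut unpacked (⊸L {Γ = b zero ∷ []} {Δ = []} ax ax))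
        where
        perm : interleave a (b ∘ suc) ++ b zero ∷ [] ↭ tabulate a ++ tabulate b
        perm = ↭-trans (++-comm _ (b zero ∷ []))
          (↭-trans (↭-prep (b zero) (interleave-↭ a (b ∘ suc))) (↭-sym (shift (b zero) (tabulate a) (tabulate (b ∘ suc)))))

      in-lStr : minusε (LStr 𝒢) w
      in-lStr = (lookupL-All w (λ e → IsSTSet⇒HasTypeST {type} (proj₂ (relST⁻ (A∈ e)))) ,
                 (λ e → rel-T (proj₁ (relST⁻ (A∈ e)))) , X≈st , hV , hE , hV∈ , (λ e → proj₁ (relST⁻ (A∈ e))) ,
                 subst id (sym (sgSequent≡tabulate w hV hE A∈)) hypergraph-derivation) , w≢ε

    generates⇒lStr : ∀ w → Generates G′ w → minusε (LStr 𝒢) w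
    generates⇒lStr w (As , As∼w , p) with pointwise⇒tabulate As∼w
    ... | F , refl , F∈ = FromDerivation.in-lStr w F F∈ p

    generates≐lStr : Generates G′ ≐ minusε (LStr 𝒢)
    generates≐lStr w = generates⇒lStr w , lStr⇒generates w

  notST⇒empty : ¬ IsSTSet X → ∀ w → ¬ LStr 𝒢 w
  notST⇒empty ¬X-st w (_ , _ , X≈st , _) =
    ¬X-st (All.tabulate (∈st⇒IsST ∘ proj₂ (X≈st _)) , proj₁ (X≈st 𝐬) (here refl) , proj₁ (X≈st 𝐭) (there (here refl)))

emptyGrammar : StrGrammar
emptyGrammar = record { T = [] ; S = at 0 [] ; rel = [] ; S-fv = λ _ () ; rel-T = λ () ; rel-fv = λ () }

emptyGrammar-empty : ∀ w → ¬ Generates emptyGrammar w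
emptyGrammar-empty [] ([] , [] , p) with AtomCount.count-⊢ 0 p
... | ()
emptyGrammar-empty (_ ∷ _) (_ ∷ _ , () ∷ _ , _)

proposition17 :
    ((G : StrGrammar) → Σ HGrammar λ 𝒢 → LStr 𝒢 ≐ Generates G) ×
    ((𝒢 : HGrammar) → Σ StrGrammar λ G → Generates G ≐ minusε (LStr 𝒢))
proposition17 = (λ G → FromStringGrammar.𝒢 G , FromStringGrammar.lStr≐generates G) , toString
  where
  toString : (𝒢 : HGrammar) → Σ StrGrammar λ G → Generates G ≐ minusε (LStr 𝒢)
  toString 𝒢 with isSTSet? (HGrammar.X 𝒢)
  ... | yes X-st = G′ , generates≐lStr
    where open ToStringGrammar.OfSTType 𝒢 X-st
  ... | no ¬X-st = emptyGrammar , λ w → ⊥-elim ∘ emptyGrammar-empty w , ⊥-elim ∘ ToStringGrammar.notST⇒empty 𝒢 ¬X-st w ∘ proj₁
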